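{- Let $G$ be a finite, simple, connected graph on $n$ vertices. Then $\sigma^-(G)\le\lceil n/2\rceil\lfloor n/2\rfloor$, and moreover: (1) $\sigma^-(G)=\lceil n/2\rceil\lfloor n/2\rfloor$ if and only if $G=K_n$; (2) $\sigma^-(G)=\lceil n/2\rceil\lfloor n/2\rfloor-1$ if and only if $G=K_n-e$; (3) $\sigma^-(G)=\lceil n/2\rceil\lfloor n/2\rfloor-2$ if and only if $G\in\{K_n-\triangle,\,K_n-2e,\,K_n-P_2\}$.
   Context: A parity-signature of $G$ is a map $\sigma:E(G)\to\{1,-1\}$ for which there is a partition $V(G)=V_1\cup V_2$ with $||V_1|-|V_2||\le1$ such that an edge has sign $-1$ (is negative) exactly when its ends lie in different sets. $\sigma^-(G)$ (the $rna$ number) is the minimum number of negative edges over all parity-signatures of $G$; equivalently, the minimum of $|E(V_1,V_2)|$ over such partitions. $K_n-e$ is $K_n$ minus one edge, $K_n-2e$ is $K_n$ minus two nonadjacent edges, $K_n-P_2$ is $K_n$ minus two adjacent edges, and $K_n-\triangle$ is $K_n$ minus the three edges of a triangle. -}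

module Defs where

open import Data.Nat using (ℕ; zero; suc; _+_; _*_; _≤_; ⌊_/2⌋; ⌈_/2⌉)
open import Data.Fin using (Fin; toℕ) renaming (zero to fzero; suc to fsuc)
open import Data.Bool using (Bool; true; false; if_then_else_; _∧_; _xor_)
open import Data.Nat using (_<ᵇ_)
open import Data.Product using (Σ; _×_; ∃-syntax)
open import Data.Sum using (_⊎_)
open import Relation.Binary.PropositionalEquality using (_≡_; _≢_)
open import Relation.Binary.Construct.Closure.ReflexiveTransitive using (Star)
open import Function.Bundles using (_⇔_)

record Graph (n : ℕ) : Set where
  field
    Adj   : Fin n → Fin n → Bool
    sym   : ∀ u v → Adj u v ≡ Adj v u
    irref : ∀ u → Adj u u ≡ false
open Graph public

_~[_]_ : ∀ {n} → Fin n → Graph n → Fin n → Set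
u ~[ G ] v = Adj G u v ≡ true

Connected : ∀ {n} → Graph n → Set
Connected {n} G = ∀ (u v : Fin n) → Star (λ x y → x ~[ G ] y) u v

Σᶠ : ∀ {n} → (Fin n → ℕ) → ℕ
Σᶠ {zero}  f = 0
Σᶠ {suc n} f = f fzero + Σᶠ (λ i → f (fsuc i))

ind : Bool → ℕ
ind true  = 1
ind false = 0

-- A bipartition of V(G): side p v = true means v ∈ V₁, false means v ∈ V₂.
Partition : ℕ → Set
Partition n = Fin n → Bool

∣V₁∣ : ∀ {n} → Partition n → ℕ
∣V₁∣ p = Σᶠ (λ v → ind (p v))

∣V₂∣ : ∀ {n} → Partition n → ℕ
∣V₂∣ p = Σᶠ (λ v → ind (if p v then false else true))

Balanced : ∀ {n} → Partition n → Set
Balanced p = (∣V₁∣ p ≤ ∣V₂∣ p + 1) × (∣V₂∣ p ≤ ∣V₁∣ p + 1)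

-- |E(V₁,V₂)|: number of edges uv (counted once, via toℕ u < toℕ v) with ends on different sides
cut : ∀ {n} → Graph n → Partition n → ℕ
cut G p = Σᶠ (λ u → Σᶠ (λ v → ind ((toℕ u <ᵇ toℕ v) ∧ (Adj G u v ∧ (p u xor p v)))))

-- k is σ⁻(G): the minimum of |E(V₁,V₂)| over balanced partitions.
IsRna : ∀ {n} → Graph n → ℕ → Set
IsRna G k = (Σ _ λ p → Balanced p × (cut G p ≡ k)) × (∀ p → Balanced p → k ≤ cut G p)

bound : ℕ → ℕ
bound n = ⌈ n /2⌉ * ⌊ n /2⌋

SameEdge : ∀ {n} → Fin n → Fin n → Fin n → Fin n → Set
SameEdge u v a b = ((u ≡ a) × (v ≡ b)) ⊎ ((u ≡ b) × (v ≡ a))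

KnMinus : ∀ {n} → Graph n → (Fin n → Fin n → Set) → Set
KnMinus {n} G F = ∀ (u v : Fin n) → u ≢ v → ((Adj G u v ≡ false) ⇔ F u v)

IsComplete : ∀ {n} → Graph n → Set
IsComplete {n} G = ∀ (u v : Fin n) → u ≢ v → u ~[ G ] v

IsKn-e : ∀ {n} → Graph n → Set
IsKn-e G = ∃[ a ] ∃[ b ] (a ≢ b) × KnMinus G (λ u v → SameEdge u v a b)

IsKn-2e : ∀ {n} → Graph n → Set
IsKn-2e G = ∃[ a ] ∃[ b ] ∃[ c ] ∃[ d ]
  (a ≢ b) × (a ≢ c) × (a ≢ d) × (b ≢ c) × (b ≢ d) × (c ≢ d) ×
  KnMinus G (λ u v → SameEdge u v a b ⊎ SameEdge u v c d)

IsKn-P2 : ∀ {n} → Graph n → Set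
IsKn-P2 G = ∃[ a ] ∃[ b ] ∃[ c ]
  (a ≢ b) × (a ≢ c) × (b ≢ c) ×
  KnMinus G (λ u v → SameEdge u v a b ⊎ SameEdge u v b c)

IsKn-tri : ∀ {n} → Graph n → Set
IsKn-tri G = ∃[ a ] ∃[ b ] ∃[ c ]
  (a ≢ b) × (a ≢ c) × (b ≢ c) ×
  KnMinus G (λ u v → SameEdge u v a b ⊎ (SameEdge u v b c ⊎ SameEdge u v c a))

module Submission where

-- For every partition p, the pairs {u, v} with u, v on different sides are either edges or
-- non-edges, so cut G p + nonEdgeCut G p = |V₁| |V₂|, which is ⌈n/2⌉⌊n/2⌋ when p is balanced.
-- Hence the gap ⌈n/2⌉⌊n/2⌋ − σ⁻(G) is the largest number of non-edges of G that one balanced partition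
-- separates. Sides prescribed for at most ⌈n/2⌉ resp. ⌊n/2⌋ vertices extend to a balanced
-- partition, so one non-edge gives a gap ≥ 1, a path of two non-edges or two disjoint non-edges
-- a gap ≥ 2, and a path of three, a path of two plus a disjoint one, three disjoint ones or a
-- star of three (using connectivity when n = 4) a gap ≥ 3. Conversely a partition cuts at most
-- two edges of a triangle.

open import Defs hiding (sym)

open import Algebra.Properties.CommutativeSemigroup using (interchange)
open import Data.Bool using (Bool; true; false; not; _∧_; _∨_; _xor_; if_then_else_)
open import Data.Bool.Properties using (∧-conicalʳ; ∧-zeroʳ; xor-comm; xor-same; ¬-not) renaming (_≟_ to _≟ᵇ_)
open import Data.Empty using (⊥; ⊥-elim)
open import Data.Fin using (Fin; toℕ; _≟_) renaming (zero to fzero; suc to fsuc)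
open import Data.Fin.Properties using (any?)
open import Data.List using (List; []; _∷_; _++_; length; map; filter)
open import Data.List.Properties using (length-++; length-map)
open import Data.List.Membership.Propositional using (_∈_; _∉_; find)
open import Data.List.Membership.Propositional.Properties using (∈-map⁺; ∈-map⁻; ∈-++⁺ˡ; ∈-++⁺ʳ; ∈-filter⁺)
open import Data.List.Relation.Unary.All as All using (All; []; _∷_)
open import Data.List.Relation.Unary.All.Properties as All using (All¬⇒¬Any; ¬Any⇒All¬)
open import Data.List.Relation.Unary.Any using (Any; here; there)
open import Data.List.Relation.Unary.Unique.Propositional using (Unique; []; _∷_)
open import Data.List.Relation.Unary.Unique.Propositional.Properties as Unique using ()
open import Data.Nat using (ℕ; zero; suc; _+_; _*_; _≤_; _<_; _<?_; _<ᵇ_; z≤n; z<s; s≤s; ⌊_/2⌋; ⌈_/2⌉)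
open import Data.Nat.Properties hiding (_≟_)
open import Data.Nat.Tactic.RingSolver using (solve-∀)
open import Data.Product using (Σ; _×_; _,_; proj₁; proj₂; swap)
open import Data.Product.Properties using (,-injectiveˡ; ,-injectiveʳ)
open import Data.Sum using (_⊎_; inj₁; inj₂; [_,_]; map₂)
import Data.Vec.Functional as Vector
open import Function using (_∘_; case_of_)
open import Function.Bundles using (_⇔_; mk⇔; Equivalence)
open import Relation.Binary.Construct.Closure.ReflexiveTransitive using (ε; _◅_)
open import Relation.Binary.PropositionalEquality
  using (_≡_; _≢_; refl; sym; trans; cong; cong₂; subst; subst₂; ≢-sym; module ≡-Reasoning)
open import Relation.Nullary using (¬_; Dec; does; yes; no; ¬?; _×-dec_; _⊎-dec_)
open import Relation.Nullary.Decidable using (dec-true; dec-false; decidable-stable)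

private
  variable
    n : ℕ

module _ {n : ℕ} where
  open import Data.List.Membership.DecPropositional (_≟_ {n}) public using (_∈?_)

Σᶠ-cong : {f g : Fin n → ℕ} → (∀ i → f i ≡ g i) → Σᶠ f ≡ Σᶠ g
Σᶠ-cong {zero}  f≗g = refl
Σᶠ-cong {suc n} f≗g = cong₂ _+_ (f≗g fzero) (Σᶠ-cong (f≗g ∘ fsuc))

Σᶠ-distrib-+ : (f g : Fin n → ℕ) → Σᶠ (λ i → f i + g i) ≡ Σᶠ f + Σᶠ g
Σᶠ-distrib-+ {zero}  f g = refl
Σᶠ-distrib-+ {suc n} f g =
  trans (cong (f fzero + g fzero +_) (Σᶠ-distrib-+ (f ∘ fsuc) (g ∘ fsuc)))
        (interchange +-commutativeSemigroup (f fzero) (g fzero) _ _)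

*-distribˡ-Σᶠ : ∀ c (f : Fin n → ℕ) → c * Σᶠ f ≡ Σᶠ (λ i → c * f i)
*-distribˡ-Σᶠ {zero}  c f = *-zeroʳ c
*-distribˡ-Σᶠ {suc n} c f =
  trans (*-distribˡ-+ c (f fzero) _) (cong (c * f fzero +_) (*-distribˡ-Σᶠ c (f ∘ fsuc)))

Σᶠ-const : ∀ n c → Σᶠ {n} (λ _ → c) ≡ n * c
Σᶠ-const zero    c = refl
Σᶠ-const (suc n) c = cong (c +_) (Σᶠ-const n c)

Σᶠ-δ : (x : Fin n) (f : Fin n → ℕ) → Σᶠ (λ v → ind (does (v ≟ x)) * f v) ≡ f x
Σᶠ-δ {suc n} fzero    f =
  trans (cong (f fzero + 0 +_) (trans (Σᶠ-const n 0) (*-zeroʳ n)))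
        (trans (+-identityʳ _) (+-identityʳ _))
Σᶠ-δ {suc n} (fsuc x) f = Σᶠ-δ x (f ∘ fsuc)

ind≤1 : ∀ b → ind b ≤ 1
ind≤1 true  = ≤-refl
ind≤1 false = z≤n

ind-split : ∀ g h → ind h ≡ ind (g ∧ h) + ind (not g ∧ h)
ind-split true  h = sym (+-identityʳ _)
ind-split false h = refl

Rel₂ : ℕ → Set
Rel₂ n = Fin n → Fin n → Bool

#ordered : Rel₂ n → ℕ
#ordered R = Σᶠ λ u → Σᶠ λ v → ind (R u v)

#pairs : Rel₂ n → ℕ
#pairs R = #ordered (λ u v → (toℕ u <ᵇ toℕ v) ∧ R u v)

#ordered-cong : {R S : Rel₂ n} → (∀ u v → R u v ≡ S u v) → #ordered R ≡ #ordered S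
#ordered-cong R≗S = Σᶠ-cong λ u → Σᶠ-cong λ v → cong ind (R≗S u v)

#ordered-+ : (R S T : Rel₂ n) → (∀ u v → ind (R u v) ≡ ind (S u v) + ind (T u v)) →
  #ordered R ≡ #ordered S + #ordered T
#ordered-+ R S T R≗S+T =
  trans (Σᶠ-cong λ u → trans (Σᶠ-cong (R≗S+T u)) (Σᶠ-distrib-+ (λ v → ind (S u v)) (λ v → ind (T u v))))
        (Σᶠ-distrib-+ (λ u → Σᶠ λ v → ind (S u v)) (λ u → Σᶠ λ v → ind (T u v)))

#ordered-split : (g R : Rel₂ n) →
  #ordered R ≡ #ordered (λ u v → g u v ∧ R u v) + #ordered (λ u v → not (g u v) ∧ R u v)
#ordered-split g R = #ordered-+ R _ _ λ u v → ind-split (g u v) (R u v)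

#pairs-split : (g R : Rel₂ n) →
  #pairs R ≡ #pairs (λ u v → g u v ∧ R u v) + #pairs (λ u v → not (g u v) ∧ R u v)
#pairs-split g R = #ordered-+ _ _ _ λ u v → split (toℕ u <ᵇ toℕ v) (g u v) (R u v)
  where
  split : ∀ c g h → ind (c ∧ h) ≡ ind (c ∧ (g ∧ h)) + ind (c ∧ (not g ∧ h))
  split true  g h = ind-split g h
  split false g h = refl

#ordered≡#pairs+#pairs : (R : Rel₂ n) → (∀ u v → R u v ≡ R v u) → (∀ u → R u u ≡ false) →
  #ordered R ≡ #pairs R + #pairs R
#ordered≡#pairs+#pairs {zero}  R R-sym irrefl = refl
#ordered≡#pairs+#pairs {suc n} R R-sym irrefl = begin
  (ind (R fzero fzero) + row) + Σᶠ (λ i → ind (R (fsuc i) fzero) + Σᶠ λ j → ind (R' i j))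
    ≡⟨ cong₂ _+_ (cong (λ b → ind b + row) (irrefl fzero)) (Σᶠ-distrib-+ (λ i → ind (R (fsuc i) fzero)) (λ i → Σᶠ λ j → ind (R' i j))) ⟩
  row + (Σᶠ (λ i → ind (R (fsuc i) fzero)) + #ordered R')
    ≡⟨ cong₂ (λ c r → row + (c + r)) (Σᶠ-cong λ i → cong ind (R-sym (fsuc i) fzero))
             (#ordered≡#pairs+#pairs R' (λ u v → R-sym (fsuc u) (fsuc v)) (irrefl ∘ fsuc)) ⟩
  row + (row + (#pairs R' + #pairs R'))
    ≡⟨ sym (+-assoc row row _) ⟩
  (row + row) + (#pairs R' + #pairs R')
    ≡⟨ interchange +-commutativeSemigroup row row _ _ ⟩
  #pairs R + #pairs R ∎
  where
  open ≡-Reasoning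
  R' : Rel₂ n
  R' i j = R (fsuc i) (fsuc j)
  row = Σᶠ λ j → ind (R fzero (fsuc j))

at : Fin n × Fin n → Rel₂ n
at (a , b) u v = does (u ≟ a) ∧ does (v ≟ b)

at-self : (x : Fin n × Fin n) → at x (proj₁ x) (proj₂ x) ≡ true
at-self (a , b) rewrite dec-true (a ≟ a) refl | dec-true (b ≟ b) refl = refl

at-≢ : ∀ (x : Fin n × Fin n) {u v} → (u , v) ≢ x → at x u v ≡ false
at-≢ (a , b) {u} {v} uv≢x with u ≟ a | v ≟ b
... | yes refl | yes refl = ⊥-elim (uv≢x refl)
... | yes refl | no _     = refl
... | no _     | _        = refl

#ordered-at : (x : Fin n × Fin n) (R : Rel₂ n) →
  #ordered (λ u v → at x u v ∧ R u v) ≡ ind (R (proj₁ x) (proj₂ x))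
#ordered-at (a , b) R =
  trans (Σᶠ-cong λ u → trans (Σᶠ-cong (factor u))
                             (trans (sym (*-distribˡ-Σᶠ (ind (does (u ≟ a))) λ v → ind (does (v ≟ b)) * ind (R a b)))
                                    (cong (ind (does (u ≟ a)) *_) (Σᶠ-δ b λ _ → ind (R a b)))))
        (Σᶠ-δ a λ _ → ind (R a b))
  where
  factor : ∀ u v → ind (at (a , b) u v ∧ R u v) ≡ ind (does (u ≟ a)) * (ind (does (v ≟ b)) * ind (R a b))
  factor u v with u ≟ a | v ≟ b
  ... | yes refl | yes refl = sym (trans (*-identityˡ _) (*-identityˡ _))
  ... | yes refl | no _     = refl
  ... | no _     | _        = refl

length≤#ordered : (R : Rel₂ n) (xs : List (Fin n × Fin n)) → Unique xs →
  All (λ (u , v) → R u v ≡ true) xs → length xs ≤ #ordered R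
length≤#ordered R []       _             _          = z≤n
length≤#ordered R (x ∷ xs) (x∉xs ∷ !xs) (Rx ∷ Rxs) = begin
  1 + length xs
    ≤⟨ +-mono-≤ (≤-reflexive (sym (trans (#ordered-at x R) (cong ind Rx))))
                (length≤#ordered R' xs !xs (All.zipWith R'-holds (x∉xs , Rxs))) ⟩
  #ordered (λ u v → at x u v ∧ R u v) + #ordered R'
    ≡⟨ sym (#ordered-split (at x) R) ⟩
  #ordered R ∎
  where
  open ≤-Reasoning
  R' : Rel₂ _
  R' u v = not (at x u v) ∧ R u v
  R'-holds : ∀ {y} → x ≢ y × R (proj₁ y) (proj₂ y) ≡ true → R' (proj₁ y) (proj₂ y) ≡ true
  R'-holds (x≢y , Ry) = cong₂ (λ b c → not b ∧ c) (at-≢ x (x≢y ∘ sym)) Ry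

#ordered≤length : (R : Rel₂ n) (xs : List (Fin n × Fin n)) →
  (∀ {u v} → R u v ≡ true → (u , v) ∈ xs) → #ordered R ≤ length xs
#ordered≤length {n} R [] R⊆[] =
  ≤-reflexive (trans (#ordered-cong R≗false) (trans (Σᶠ-cong {n} λ _ → zeros) zeros))
  where
  R≗false : ∀ u v → R u v ≡ false
  R≗false u v with R u v in Ruv
  ... | true  = case R⊆[] Ruv of λ ()
  ... | false = refl
  zeros : Σᶠ {n} (λ _ → 0) ≡ 0
  zeros = trans (Σᶠ-const n 0) (*-zeroʳ n)
#ordered≤length R (x ∷ xs) R⊆x∷xs = begin
  #ordered R
    ≡⟨ #ordered-split (at x) R ⟩
  #ordered (λ u v → at x u v ∧ R u v) + #ordered R'
    ≤⟨ +-mono-≤ (≤-trans (≤-reflexive (#ordered-at x R)) (ind≤1 _)) (#ordered≤length R' xs R'⊆xs) ⟩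
  1 + length xs ∎
  where
  open ≤-Reasoning
  R' : Rel₂ _
  R' u v = not (at x u v) ∧ R u v
  R'⊆xs : ∀ {u v} → R' u v ≡ true → (u , v) ∈ xs
  R'⊆xs {u} {v} R'uv with R⊆x∷xs (∧-conicalʳ _ _ R'uv)
  ... | here refl = case trans (sym R'uv) (cong (λ b → not b ∧ R u v) (at-self x)) of λ ()
  ... | there uv∈xs = uv∈xs

m+m≡n+n⇒m≡n : ∀ m n → m + m ≡ n + n → m ≡ n
m+m≡n+n⇒m≡n zero    zero    _  = refl
m+m≡n+n⇒m≡n (suc m) (suc n) eq =
  cong suc (m+m≡n+n⇒m≡n m n (suc-injective (trans (sym (+-suc m m)) (trans (suc-injective eq) (+-suc n n)))))

m+m≤n+n⇒m≤n : ∀ m n → m + m ≤ n + n → m ≤ n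
m+m≤n+n⇒m≤n m n m+m≤n+n = ≮⇒≥ λ n<m → <⇒≱ (+-mono-< n<m n<m) m+m≤n+n

∣V₁∣+∣V₂∣≡n : (p : Partition n) → ∣V₁∣ p + ∣V₂∣ p ≡ n
∣V₁∣+∣V₂∣≡n {n} p = begin
  ∣V₁∣ p + ∣V₂∣ p                 ≡⟨ Σᶠ-distrib-+ (ind ∘ p) (λ v → ind (if p v then false else true)) ⟨
  Σᶠ (λ v → ind (p v) + ind (if p v then false else true)) ≡⟨ Σᶠ-cong (one-side ∘ p) ⟩
  Σᶠ {n} (λ _ → 1)                 ≡⟨ Σᶠ-const n 1 ⟩
  n * 1                            ≡⟨ *-identityʳ n ⟩
  n                                ∎
  where
  open ≡-Reasoning
  one-side : ∀ b → ind b + ind (if b then false else true) ≡ 1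
  one-side true  = refl
  one-side false = refl

#ordered-xor : (p : Partition n) → #ordered (λ u v → p u xor p v) ≡ ∣V₂∣ p * ∣V₁∣ p + ∣V₁∣ p * ∣V₂∣ p
#ordered-xor p = begin
  #ordered (λ u v → p u xor p v)
    ≡⟨ Σᶠ-cong (λ u → Σᶠ-cong λ v → ind-xor (p u) (p v)) ⟩
  Σᶠ (λ u → Σᶠ λ v → in₁ u * in₂ v + in₂ u * in₁ v)
    ≡⟨ Σᶠ-cong row ⟩
  Σᶠ (λ u → ∣V₂∣ p * in₁ u + ∣V₁∣ p * in₂ u)
    ≡⟨ Σᶠ-distrib-+ (λ u → ∣V₂∣ p * in₁ u) (λ u → ∣V₁∣ p * in₂ u) ⟩
  Σᶠ (λ u → ∣V₂∣ p * in₁ u) + Σᶠ (λ u → ∣V₁∣ p * in₂ u)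
    ≡⟨ cong₂ _+_ (*-distribˡ-Σᶠ (∣V₂∣ p) in₁) (*-distribˡ-Σᶠ (∣V₁∣ p) in₂) ⟨
  ∣V₂∣ p * ∣V₁∣ p + ∣V₁∣ p * ∣V₂∣ p ∎
  where
  open ≡-Reasoning
  in₁ in₂ : Fin _ → ℕ
  in₁ v = ind (p v)
  in₂ v = ind (if p v then false else true)
  ind-xor : ∀ x y → ind (x xor y) ≡ ind x * ind (if y then false else true) + ind (if x then false else true) * ind y
  ind-xor true  true  = refl
  ind-xor true  false = refl
  ind-xor false true  = refl
  ind-xor false false = refl
  row : ∀ u → Σᶠ (λ v → in₁ u * in₂ v + in₂ u * in₁ v) ≡ ∣V₂∣ p * in₁ u + ∣V₁∣ p * in₂ u
  row u = begin
    Σᶠ (λ v → in₁ u * in₂ v + in₂ u * in₁ v)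
      ≡⟨ Σᶠ-distrib-+ (λ v → in₁ u * in₂ v) (λ v → in₂ u * in₁ v) ⟩
    Σᶠ (λ v → in₁ u * in₂ v) + Σᶠ (λ v → in₂ u * in₁ v)
      ≡⟨ cong₂ _+_ (*-distribˡ-Σᶠ (in₁ u) in₂) (*-distribˡ-Σᶠ (in₂ u) in₁) ⟨
    in₁ u * ∣V₂∣ p + in₂ u * ∣V₁∣ p
      ≡⟨ cong₂ _+_ (*-comm (in₁ u) _) (*-comm (in₂ u) _) ⟩
    ∣V₂∣ p * in₁ u + ∣V₁∣ p * in₂ u ∎

#pairs-xor : (p : Partition n) → #pairs (λ u v → p u xor p v) ≡ ∣V₁∣ p * ∣V₂∣ p
#pairs-xor p = m+m≡n+n⇒m≡n _ _ (begin
  #pairs crossing + #pairs crossing  ≡⟨ #ordered≡#pairs+#pairs crossing (λ u v → xor-comm (p u) (p v)) (xor-same ∘ p) ⟨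
  #ordered crossing                  ≡⟨ #ordered-xor p ⟩
  ∣V₂∣ p * ∣V₁∣ p + ∣V₁∣ p * ∣V₂∣ p  ≡⟨ cong (_+ ∣V₁∣ p * ∣V₂∣ p) (*-comm (∣V₂∣ p) _) ⟩
  ∣V₁∣ p * ∣V₂∣ p + ∣V₁∣ p * ∣V₂∣ p  ∎)
  where
  open ≡-Reasoning
  crossing : Rel₂ _
  crossing u v = p u xor p v

-- Non-edges across a partition

_≁[_]_ : Fin n → Graph n → Fin n → Set
u ≁[ G ] v = Adj G u v ≡ false

nonEdgeCut : Graph n → Partition n → ℕ
nonEdgeCut G p = #pairs (λ u v → not (Adj G u v) ∧ (p u xor p v))

cut+nonEdgeCut≡∣V₁∣*∣V₂∣ : (G : Graph n) (p : Partition n) → cut G p + nonEdgeCut G p ≡ ∣V₁∣ p * ∣V₂∣ p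
cut+nonEdgeCut≡∣V₁∣*∣V₂∣ G p = trans (sym (#pairs-split (Adj G) (λ u v → p u xor p v))) (#pairs-xor p)

*≡⌈+/2⌉*⌊+/2⌋ : ∀ a b → a ≤ b + 1 → b ≤ a + 1 → a * b ≡ ⌈ (a + b) /2⌉ * ⌊ (a + b) /2⌋
*≡⌈+/2⌉*⌊+/2⌋ zero          zero          _ _ = refl
*≡⌈+/2⌉*⌊+/2⌋ zero          (suc zero)    _ _ = refl
*≡⌈+/2⌉*⌊+/2⌋ (suc zero)    zero          _ _ = refl
*≡⌈+/2⌉*⌊+/2⌋ (suc (suc a)) zero          (s≤s ()) _
*≡⌈+/2⌉*⌊+/2⌋ zero          (suc (suc b)) _ (s≤s ())
*≡⌈+/2⌉*⌊+/2⌋ (suc a)       (suc b)       a≤b+1 b≤a+1 rewrite +-suc a b = begin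
  suc a * suc b               ≡⟨ expand a b ⟩
  suc (a + b + a * b)         ≡⟨ cong (λ m → suc (m + a * b)) (⌊n/2⌋+⌈n/2⌉≡n (a + b)) ⟨
  suc (⌊ a + b /2⌋ + ⌈ a + b /2⌉ + a * b)
    ≡⟨ cong suc (cong₂ _+_ (+-comm ⌊ a + b /2⌋ _) (*≡⌈+/2⌉*⌊+/2⌋ a b (≤-pred a≤b+1) (≤-pred b≤a+1))) ⟩
  suc (⌈ a + b /2⌉ + ⌊ a + b /2⌋ + ⌈ a + b /2⌉ * ⌊ a + b /2⌋)
                              ≡⟨ expand ⌈ a + b /2⌉ ⌊ a + b /2⌋ ⟨
  suc ⌈ a + b /2⌉ * suc ⌊ a + b /2⌋ ∎
  where
  open ≡-Reasoning
  expand : ∀ x y → suc x * suc y ≡ suc (x + y + x * y)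
  expand = solve-∀

balanced⇒∣V₁∣*∣V₂∣≡bound : (p : Partition n) → Balanced p → ∣V₁∣ p * ∣V₂∣ p ≡ bound n
balanced⇒∣V₁∣*∣V₂∣≡bound {n} p (V₁≤V₂+1 , V₂≤V₁+1) =
  trans (*≡⌈+/2⌉*⌊+/2⌋ (∣V₁∣ p) (∣V₂∣ p) V₁≤V₂+1 V₂≤V₁+1)
        (cong (λ m → ⌈ m /2⌉ * ⌊ m /2⌋) (∣V₁∣+∣V₂∣≡n p))

module _ (G : Graph n) (p : Partition n) where

  private
    R : Rel₂ n
    R u v = not (Adj G u v) ∧ (p u xor p v)

    #ordered≡2nonEdgeCut : #ordered R ≡ nonEdgeCut G p + nonEdgeCut G p
    #ordered≡2nonEdgeCut = #ordered≡#pairs+#pairs R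
      (λ u v → cong₂ (λ a c → not a ∧ c) (Graph.sym G u v) (xor-comm (p u) (p v)))
      (λ u → trans (cong (not (Adj G u u) ∧_) (xor-same (p u))) (∧-zeroʳ _))

    length-++-swap : (es : List (Fin n × Fin n)) → length (es ++ map swap es) ≡ length es + length es
    length-++-swap es = trans (length-++ es) (cong (length es +_) (length-map swap es))

  -- Both bounds below count ordered pairs, where each non-edge appears in both orientations.
  NonEdgeAcross : Fin n × Fin n → Set
  NonEdgeAcross (a , b) = p a ≡ true × p b ≡ false × a ≁[ G ] b

  length≤nonEdgeCut : (es : List (Fin n × Fin n)) → Unique es → All NonEdgeAcross es →
    length es ≤ nonEdgeCut G p
  length≤nonEdgeCut es !es across = m+m≤n+n⇒m≤n _ _ (begin
    length es + length es       ≡⟨ length-++-swap es ⟨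
    length (es ++ map swap es)  ≤⟨ length≤#ordered R _ unique (All.++⁺ (All.map forward across)
                                                                      (All.map⁺ (All.map backward across))) ⟩
    #ordered R                  ≡⟨ #ordered≡2nonEdgeCut ⟩
    nonEdgeCut G p + nonEdgeCut G p ∎)
    where
    open ≤-Reasoning
    forward : ∀ {e} → NonEdgeAcross e → R (proj₁ e) (proj₂ e) ≡ true
    forward (pa , pb , a≁b) rewrite pa | pb | a≁b = refl
    backward : ∀ {e} → NonEdgeAcross e → R (proj₂ e) (proj₁ e) ≡ true
    backward {a , b} (pa , pb , a≁b) rewrite pa | pb | Graph.sym G b a | a≁b = refl
    disjoint : ∀ {e} → e ∈ es → e ∈ map swap es → ⊥
    disjoint e∈es e∈swapped with ∈-map⁻ swap e∈swapped
    ... | _ , y∈es , refl =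
      case trans (sym (proj₁ (All.lookup across e∈es))) (proj₁ (proj₂ (All.lookup across y∈es))) of λ ()
    unique : Unique (es ++ map swap es)
    unique = Unique.++⁺ !es (Unique.map⁺ (cong swap) !es) (λ (e∈es , e∈swapped) → disjoint e∈es e∈swapped)

  crossing? : (e : Fin n × Fin n) → Dec (p (proj₁ e) xor p (proj₂ e) ≡ true)
  crossing? (a , b) = p a xor p b ≟ᵇ true

  crossings : List (Fin n × Fin n) → ℕ
  crossings []             = 0
  crossings ((a , b) ∷ es) = ind (p a xor p b) + crossings es

  length-filter-crossing? : ∀ es → length (filter crossing? es) ≡ crossings es
  length-filter-crossing? [] = refl
  length-filter-crossing? ((a , b) ∷ es) with p a xor p b
  ... | true  = cong suc (length-filter-crossing? es)
  ... | false = length-filter-crossing? es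

  crossings≤length : ∀ es → crossings es ≤ length es
  crossings≤length []             = z≤n
  crossings≤length ((a , b) ∷ es) = +-mono-≤ (ind≤1 _) (crossings≤length es)

  -- A partition cuts an even number of the edges of a triangle.
  crossings-triangle : ∀ a b c → crossings ((a , b) ∷ (b , c) ∷ (c , a) ∷ []) ≤ 2
  crossings-triangle a b c = at-most-two (p a) (p b) (p c)
    where
    at-most-two : ∀ x y z → ind (x xor y) + (ind (y xor z) + (ind (z xor x) + 0)) ≤ 2
    at-most-two true  true  true  = z≤n
    at-most-two true  true  false = ≤-refl
    at-most-two true  false true  = ≤-refl
    at-most-two true  false false = ≤-refl
    at-most-two false true  true  = ≤-refl
    at-most-two false true  false = ≤-refl
    at-most-two false false true  = ≤-refl
    at-most-two false false false = z≤n

  nonEdgeCut≤crossings : (es : List (Fin n × Fin n)) →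
    (∀ {u v} → u ≢ v → u ≁[ G ] v → Any (λ (a , b) → SameEdge u v a b) es) →
    nonEdgeCut G p ≤ crossings es
  nonEdgeCut≤crossings es covers = m+m≤n+n⇒m≤n _ _ (begin
    nonEdgeCut G p + nonEdgeCut G p  ≡⟨ #ordered≡2nonEdgeCut ⟨
    #ordered R                       ≤⟨ #ordered≤length R (cs ++ map swap cs) R⊆ ⟩
    length (cs ++ map swap cs)       ≡⟨ length-++-swap cs ⟩
    length cs + length cs            ≡⟨ cong₂ _+_ (length-filter-crossing? es) (length-filter-crossing? es) ⟩
    crossings es + crossings es      ∎)
    where
    open ≤-Reasoning
    cs = filter crossing? es
    crossing⇒≢ : ∀ {u v} → p u xor p v ≡ true → u ≢ v
    crossing⇒≢ {u} pu≠pu refl = case trans (sym pu≠pu) (xor-same (p u)) of λ ()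
    R⊆ : ∀ {u v} → R u v ≡ true → (u , v) ∈ cs ++ map swap cs
    R⊆ {u} {v} Ruv with Adj G u v in u≁v | p u xor p v in pu≠pv
    ... | true  | _     = case Ruv of λ ()
    ... | false | false = case Ruv of λ ()
    ... | false | true  with find (covers (crossing⇒≢ pu≠pv) u≁v)
    ...   | _ , e∈es , inj₁ (refl , refl) = ∈-++⁺ˡ (∈-filter⁺ crossing? e∈es pu≠pv)
    ...   | _ , e∈es , inj₂ (refl , refl) =
      ∈-++⁺ʳ cs (∈-map⁺ swap (∈-filter⁺ crossing? e∈es (trans (xor-comm (p v) (p u)) pu≠pv)))

  KnMinus⇒nonEdgeCut≤crossings : ∀ {F} (es : List (Fin n × Fin n)) → KnMinus G F →
    (∀ {u v} → F u v → Any (λ (a , b) → SameEdge u v a b) es) → nonEdgeCut G p ≤ crossings es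
  KnMinus⇒nonEdgeCut≤crossings es G≡Kₙ-F F⊆es =
    nonEdgeCut≤crossings es λ u≢v u≁v → F⊆es (Equivalence.to (G≡Kₙ-F _ _ u≢v) u≁v)

-- Extending a prescription of sides to a balanced partition

count : (Fin n → Bool) → ℕ
count t = Σᶠ (ind ∘ t)

count≤n : (t : Fin n → Bool) → count t ≤ n
count≤n {zero}  t = z≤n
count≤n {suc n} t = +-mono-≤ (ind≤1 (t fzero)) (count≤n (t ∘ fsuc))

count-disjoint : (t f : Fin n → Bool) → (∀ v → t v ≡ true → f v ≡ false) → count t + count f ≤ n
count-disjoint t f t∩f=∅ = begin
  count t + count f                        ≡⟨ Σᶠ-distrib-+ (ind ∘ t) (ind ∘ f) ⟨
  Σᶠ (λ v → ind (t v) + ind (f v))         ≡⟨ Σᶠ-cong (λ v → ind-∨ (t v) (f v) (t∩f=∅ v)) ⟨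
  count (λ v → t v ∨ f v)                  ≤⟨ count≤n _ ⟩
  _                                        ∎
  where
  open ≤-Reasoning
  ind-∨ : ∀ x y → (x ≡ true → y ≡ false) → ind (x ∨ y) ≡ ind x + ind y
  ind-∨ true  y y≡false rewrite y≡false refl = refl
  ind-∨ false y _ = refl

count-∈? : (xs : List (Fin n)) → Unique xs → count (λ v → does (v ∈? xs)) ≡ length xs
count-∈? {n} []       []           = trans (Σᶠ-const n 0) (*-zeroʳ n)
count-∈? {n} (x ∷ xs) (x∉xs ∷ !xs) = begin
  count (λ v → does (v ≟ x) ∨ does (v ∈? xs))
    ≡⟨ Σᶠ-cong (λ v → ind-∨ v) ⟩
  Σᶠ (λ v → ind (does (v ≟ x)) + ind (does (v ∈? xs)))
    ≡⟨ Σᶠ-distrib-+ (λ v → ind (does (v ≟ x))) (λ v → ind (does (v ∈? xs))) ⟩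
  Σᶠ (λ v → ind (does (v ≟ x))) + count (λ v → does (v ∈? xs))
    ≡⟨ cong₂ _+_ (trans (Σᶠ-cong {n} λ v → sym (*-identityʳ (ind (does (v ≟ x))))) (Σᶠ-δ x λ _ → 1)) (count-∈? xs !xs) ⟩
  1 + length xs ∎
  where
  open ≡-Reasoning
  ind-∨ : ∀ v → ind (does (v ≟ x) ∨ does (v ∈? xs)) ≡ ind (does (v ≟ x)) + ind (does (v ∈? xs))
  ind-∨ v with v ≟ x
  ... | yes refl = cong (suc ∘ ind) (sym (dec-false (v ∈? xs) (All¬⇒¬Any x∉xs)))
  ... | no _     = refl

Extension : (t f : Fin n → Bool) (a b : ℕ) → Set
Extension {n} t f a b =
  Σ (Partition n) λ p → (∀ v → t v ≡ true → p v ≡ true) × (∀ v → f v ≡ true → p v ≡ false) × ∣V₁∣ p ≡ a × ∣V₂∣ p ≡ b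

-- Vertex by vertex: prescribed vertices go to their side, a free vertex goes to V₁ while V₁ has room.
extend : (t f : Fin n → Bool) → (∀ v → t v ≡ true → f v ≡ false) →
  ∀ a b → a + b ≡ n → count t ≤ a → count f ≤ b → Extension t f a b
extend {zero}  t f _ zero zero _ _ _ = (λ ()) , (λ ()) , (λ ()) , refl , refl
extend {suc n} t f t∩f=∅ a b a+b≡1+n #t≤a #f≤b = go (t fzero) (f fzero) a b refl refl a+b≡1+n #t≤a #f≤b
  where
  t' f' : Fin n → Bool
  t' = t ∘ fsuc
  f' = f ∘ fsuc

  extend' : ∀ a b → a + b ≡ n → count t' ≤ a → count f' ≤ b → Extension t' f' a b
  extend' = extend t' f' (t∩f=∅ ∘ fsuc)

  put-true : ∀ {a b} → f fzero ≡ false → Extension t' f' a b → Extension t f (suc a) b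
  put-true f₀ (q , t'⊆q , f'∩q=∅ , ∣q₁∣ , ∣q₂∣) =
    true Vector.∷ q ,
    (λ { fzero _ → refl ; (fsuc v) → t'⊆q v }) ,
    (λ { fzero f₀≡true → case trans (sym f₀) f₀≡true of λ () ; (fsuc v) → f'∩q=∅ v }) ,
    cong suc ∣q₁∣ , ∣q₂∣

  put-false : ∀ {a b} → t fzero ≡ false → Extension t' f' a b → Extension t f a (suc b)
  put-false t₀ (q , t'⊆q , f'∩q=∅ , ∣q₁∣ , ∣q₂∣) =
    false Vector.∷ q ,
    (λ { fzero t₀≡true → case trans (sym t₀) t₀≡true of λ () ; (fsuc v) → t'⊆q v }) ,
    (λ { fzero _ → refl ; (fsuc v) → f'∩q=∅ v }) ,
    ∣q₁∣ , cong suc ∣q₂∣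

  put-false-filling : ∀ {a} b → t fzero ≡ false → a + b ≡ suc n → count t' ≡ a → count f' ≤ b →
    Extension t f a b
  put-false-filling {a} zero _ eq #t'≡a _ =
    ⊥-elim (1+n≰n (≤-trans (≤-reflexive (trans (sym eq) (+-identityʳ a))) (≤-trans (≤-reflexive (sym #t'≡a)) (count≤n t'))))
  put-false-filling {a} (suc b) t₀ eq #t'≡a #f'≤1+b =
    put-false t₀ (extend' a b a+b≡n (≤-reflexive #t'≡a) (+-cancelˡ-≤ a _ _ (begin
      a + count f'         ≡⟨ cong (_+ count f') #t'≡a ⟨
      count t' + count f'  ≤⟨ count-disjoint t' f' (t∩f=∅ ∘ fsuc) ⟩
      n                    ≡⟨ a+b≡n ⟨
      a + b                ∎)))
    where
    open ≤-Reasoning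
    a+b≡n : a + b ≡ n
    a+b≡n = suc-injective (trans (sym (+-suc a b)) eq)

  go : ∀ x y a b → t fzero ≡ x → f fzero ≡ y → a + b ≡ suc n →
       ind x + count t' ≤ a → ind y + count f' ≤ b → Extension t f a b
  go true  true  _       _       t₀ f₀ _  _          _          = case trans (sym f₀) (t∩f=∅ fzero t₀) of λ ()
  go true  false (suc a) b       t₀ f₀ eq (s≤s #t'≤a) #f'≤b      = put-true f₀ (extend' a b (suc-injective eq) #t'≤a #f'≤b)
  go false true  a       (suc b) t₀ f₀ eq #t'≤a      (s≤s #f'≤b) =
    put-false t₀ (extend' a b (suc-injective (trans (sym (+-suc a b)) eq)) #t'≤a #f'≤b)
  go false false a       b       t₀ f₀ eq #t'≤a      #f'≤b      with count t' <? a
  go false false (suc a) b       t₀ f₀ eq _          #f'≤b | yes (s≤s #t'≤a) =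
    put-true f₀ (extend' a b (suc-injective eq) #t'≤a #f'≤b)
  ... | no #t'≮a = put-false-filling b t₀ eq (≤-antisym #t'≤a (≮⇒≥ #t'≮a)) #f'≤b

unique-++⁻ : ∀ {A : Set} (xs : List A) {ys} → Unique (xs ++ ys) →
  Unique xs × Unique ys × (∀ {v} → v ∈ xs → v ∈ ys → ⊥)
unique-++⁻ []       !ys              = [] , !ys , λ ()
unique-++⁻ (x ∷ xs) (x∉xs++ys ∷ !xs++ys) with unique-++⁻ xs !xs++ys
... | !xs , !ys , xs#ys =
  All.++⁻ˡ xs x∉xs++ys ∷ !xs , !ys ,
  λ { (here refl) v∈ys → All¬⇒¬Any (All.++⁻ʳ xs x∉xs++ys) v∈ys
    ; (there v∈xs) v∈ys → xs#ys v∈xs v∈ys }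

⌈n/2⌉≤⌊n/2⌋+1 : ∀ n → ⌈ n /2⌉ ≤ ⌊ n /2⌋ + 1
⌈n/2⌉≤⌊n/2⌋+1 zero          = z≤n
⌈n/2⌉≤⌊n/2⌋+1 (suc zero)    = ≤-refl
⌈n/2⌉≤⌊n/2⌋+1 (suc (suc n)) = s≤s (⌈n/2⌉≤⌊n/2⌋+1 n)

separate : (T F : List (Fin n)) → Unique (T ++ F) → length T ≡ ⌈ length (T ++ F) /2⌉ →
  Σ (Partition n) λ p → Balanced p × All (λ v → p v ≡ true) T × All (λ v → p v ≡ false) F
separate {n} T F !T++F ∣T∣≡⌈m/2⌉
  with extend t f t∩f=∅ ⌈ n /2⌉ ⌊ n /2⌋ (trans (+-comm ⌈ n /2⌉ _) (⌊n/2⌋+⌈n/2⌉≡n n)) #t≤⌈n/2⌉ #f≤⌊n/2⌋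
  where
  !T = proj₁ (unique-++⁻ T !T++F)
  !F = proj₁ (proj₂ (unique-++⁻ T !T++F))
  T#F = proj₂ (proj₂ (unique-++⁻ T !T++F))
  m = length (T ++ F)
  t f : Fin n → Bool
  t v = does (v ∈? T)
  f v = does (v ∈? F)
  t∩f=∅ : ∀ v → t v ≡ true → f v ≡ false
  t∩f=∅ v tv with v ∈? T | v ∈? F
  ... | yes v∈T | yes v∈F = ⊥-elim (T#F v∈T v∈F)
  ... | no _    | yes _   = case tv of λ ()
  ... | _       | no _    = refl
  m≤n : m ≤ n
  m≤n = ≤-trans (≤-reflexive (sym (count-∈? (T ++ F) !T++F))) (count≤n _)
  ∣F∣≡⌊m/2⌋ : length F ≡ ⌊ m /2⌋
  ∣F∣≡⌊m/2⌋ = +-cancelˡ-≡ (length T) _ _ (begin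
    length T + length F  ≡⟨ length-++ T ⟨
    m                    ≡⟨ ⌊n/2⌋+⌈n/2⌉≡n m ⟨
    ⌊ m /2⌋ + ⌈ m /2⌉     ≡⟨ +-comm ⌊ m /2⌋ _ ⟩
    ⌈ m /2⌉ + ⌊ m /2⌋     ≡⟨ cong (_+ ⌊ m /2⌋) ∣T∣≡⌈m/2⌉ ⟨
    length T + ⌊ m /2⌋    ∎)
    where open ≡-Reasoning
  #t≤⌈n/2⌉ : count t ≤ ⌈ n /2⌉
  #t≤⌈n/2⌉ = ≤-trans (≤-reflexive (trans (count-∈? T !T) ∣T∣≡⌈m/2⌉)) (⌈n/2⌉-mono m≤n)
  #f≤⌊n/2⌋ : count f ≤ ⌊ n /2⌋
  #f≤⌊n/2⌋ = ≤-trans (≤-reflexive (trans (count-∈? F !F) ∣F∣≡⌊m/2⌋)) (⌊n/2⌋-mono m≤n)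
... | p , t⊆p , f∩p=∅ , ∣V₁∣≡⌈n/2⌉ , ∣V₂∣≡⌊n/2⌋ =
  p ,
  (subst₂ _≤_ (sym ∣V₁∣≡⌈n/2⌉) (cong (_+ 1) (sym ∣V₂∣≡⌊n/2⌋)) (⌈n/2⌉≤⌊n/2⌋+1 n) ,
   subst₂ _≤_ (sym ∣V₂∣≡⌊n/2⌋) (cong (_+ 1) (sym ∣V₁∣≡⌈n/2⌉)) (≤-trans (⌊n/2⌋≤⌈n/2⌉ n) (m≤m+n _ 1))) ,
  All.tabulate (λ {v} v∈T → t⊆p v (dec-true (v ∈? T) v∈T)) ,
  All.tabulate (λ {v} v∈F → f∩p=∅ v (dec-true (v ∈? F) v∈F))

connected⇒¬isolated : {G : Graph n} → Connected G → ∀ {c x} → c ≢ x → (∀ v → c ≁[ G ] v) → ⊥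
connected⇒¬isolated conn {c} {x} c≢x c-isolated with conn c x
... | ε         = c≢x refl
... | c~v ◅ _   = case trans (sym c~v) (c-isolated _) of λ ()

-- Shape of the complement

sameEdge? : (u v a b : Fin n) → Dec (SameEdge u v a b)
sameEdge? u v a b = (u ≟ a ×-dec v ≟ b) ⊎-dec (u ≟ b ×-dec v ≟ a)

sameEdge-sym : {u v a b : Fin n} → SameEdge u v a b → SameEdge v u a b
sameEdge-sym (inj₁ (u≡a , v≡b)) = inj₂ (v≡b , u≡a)
sameEdge-sym (inj₂ (u≡b , v≡a)) = inj₁ (v≡a , u≡b)

sameEdge-flip : {u v a b : Fin n} → SameEdge u v a b → SameEdge a b u v
sameEdge-flip (inj₁ (refl , refl)) = inj₁ (refl , refl)
sameEdge-flip (inj₂ (refl , refl)) = inj₂ (refl , refl)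

pair-in-edge : {u v a b : Fin n} → u ∈ a ∷ b ∷ [] → v ∈ a ∷ b ∷ [] → u ≢ v → SameEdge u v a b
pair-in-edge (here refl)         (here refl)         u≢v = ⊥-elim (u≢v refl)
pair-in-edge (here refl)         (there (here refl)) _   = inj₁ (refl , refl)
pair-in-edge (there (here refl)) (here refl)         _   = inj₂ (refl , refl)
pair-in-edge (there (here refl)) (there (here refl)) u≢v = ⊥-elim (u≢v refl)

pair-in-triangle : {u v x y c : Fin n} → u ∈ x ∷ y ∷ c ∷ [] → v ∈ x ∷ y ∷ c ∷ [] → u ≢ v →
  SameEdge u v x c ⊎ (SameEdge u v c y ⊎ SameEdge u v y x)
pair-in-triangle (here refl)                 (here refl)                 u≢v = ⊥-elim (u≢v refl)
pair-in-triangle (here refl)                 (there (here refl))         _   = inj₂ (inj₂ (inj₂ (refl , refl)))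
pair-in-triangle (here refl)                 (there (there (here refl))) _   = inj₁ (inj₁ (refl , refl))
pair-in-triangle (there (here refl))         (here refl)                 _   = inj₂ (inj₂ (inj₁ (refl , refl)))
pair-in-triangle (there (here refl))         (there (here refl))         u≢v = ⊥-elim (u≢v refl)
pair-in-triangle (there (here refl))         (there (there (here refl))) _   = inj₂ (inj₁ (inj₂ (refl , refl)))
pair-in-triangle (there (there (here refl))) (here refl)                 _   = inj₁ (inj₂ (refl , refl))
pair-in-triangle (there (there (here refl))) (there (here refl))         _   = inj₂ (inj₁ (inj₁ (refl , refl)))
pair-in-triangle (there (there (here refl))) (there (there (here refl))) u≢v = ⊥-elim (u≢v refl)

module _ (G : Graph n) where

  ≁-sym : {u v : Fin n} → u ≁[ G ] v → v ≁[ G ] u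
  ≁-sym {u} {v} u≁v = trans (Graph.sym G v u) u≁v

  sameEdge-≁ : {u v a b : Fin n} → a ≁[ G ] b → SameEdge u v a b → u ≁[ G ] v
  sameEdge-≁ a≁b (inj₁ (refl , refl)) = a≁b
  sameEdge-≁ a≁b (inj₂ (refl , refl)) = ≁-sym a≁b

-- cherry: the non-edges x c and y c; matching: a₁ b₁ is the only non-edge at a₁ or b₁.
data ComplementShape (G : Graph n) : Set where
  complete : IsComplete G → ComplementShape G
  single   : IsKn-e G → ComplementShape G
  cherry   : ∀ {x y c} → Unique (x ∷ y ∷ c ∷ []) → x ≁[ G ] c → y ≁[ G ] c → ComplementShape G
  matching : ∀ {a₁ a₂ b₁ b₂} → Unique (a₁ ∷ a₂ ∷ b₁ ∷ b₂ ∷ []) → a₁ ≁[ G ] b₁ → a₂ ≁[ G ] b₂ →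
             (∀ {u v} → u ≢ v → u ≁[ G ] v → ¬ SameEdge u v a₁ b₁ → u ∉ a₁ ∷ b₁ ∷ []) →
             ComplementShape G

complementShape : (G : Graph n) → ComplementShape G
complementShape G with any? (λ a → any? λ b → ¬? (a ≟ b) ×-dec (Adj G a b ≟ᵇ false))
... | no ∄non-edge = complete λ u v u≢v → ¬-not λ u≁v → ∄non-edge (u , v , u≢v , u≁v)
... | yes (a , b , a≢b , a≁b)
  with any? (λ c → ¬? (c ∈? (a ∷ b ∷ [])) ×-dec ((Adj G a c ≟ᵇ false) ⊎-dec (Adj G b c ≟ᵇ false)))
...   | yes (c , c∉ab , inj₁ a≁c) = cherry ((≢-sym c≢b ∷ b≢a ∷ []) ∷ (c≢a ∷ []) ∷ [] ∷ []) (≁-sym G a≁b) (≁-sym G a≁c)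
  where
  c≢a = c∉ab ∘ here
  c≢b = c∉ab ∘ there ∘ here
  b≢a = ≢-sym a≢b
...   | yes (c , c∉ab , inj₂ b≁c) = cherry ((≢-sym c≢a ∷ a≢b ∷ []) ∷ (c≢b ∷ []) ∷ [] ∷ []) a≁b (≁-sym G b≁c)
  where
  c≢a = c∉ab ∘ here
  c≢b = c∉ab ∘ there ∘ here
...   | no ∄c with any? (λ u → any? λ v → ¬? (u ≟ v) ×-dec ((Adj G u v ≟ᵇ false) ×-dec ¬? (sameEdge? u v a b)))
...     | no ∄uv = single (a , b , a≢b , λ u v u≢v →
            mk⇔ (λ u≁v → decidable-stable (sameEdge? u v a b) λ ¬same → ∄uv (u , v , u≢v , u≁v , ¬same))
                (sameEdge-≁ G a≁b))
...     | yes (c , d , c≢d , c≁d , ¬cd≡ab) = matching !acbd a≁b c≁d avoids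
  where
  avoids : ∀ {u v} → u ≢ v → u ≁[ G ] v → ¬ SameEdge u v a b → u ∉ a ∷ b ∷ []
  avoids {v = v} u≢v u≁v ¬same (here refl) = ∄c (v , v∉ab , inj₁ u≁v)
    where
    v∉ab : v ∉ a ∷ b ∷ []
    v∉ab (here refl)         = u≢v refl
    v∉ab (there (here refl)) = ¬same (inj₁ (refl , refl))
  avoids {v = v} u≢v u≁v ¬same (there (here refl)) = ∄c (v , v∉ab , inj₂ u≁v)
    where
    v∉ab : v ∉ a ∷ b ∷ []
    v∉ab (here refl)         = ¬same (inj₂ (refl , refl))
    v∉ab (there (here refl)) = u≢v refl
  c∉ab = avoids c≢d c≁d ¬cd≡ab
  d∉ab = avoids (≢-sym c≢d) (≁-sym G c≁d) (¬cd≡ab ∘ sameEdge-sym)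
  !acbd : Unique (a ∷ c ∷ b ∷ d ∷ [])
  !acbd = (≢-sym (c∉ab ∘ here) ∷ a≢b ∷ ≢-sym (d∉ab ∘ here) ∷ []) ∷
          (c∉ab ∘ there ∘ here ∷ c≢d ∷ []) ∷ (≢-sym (d∉ab ∘ there ∘ here) ∷ []) ∷ [] ∷ []

-- Consequences for σ⁻(G)

module RnaFacts {G : Graph n} {k : ℕ} (rna : IsRna G k) where

  rna+nonEdgeCut≤bound : (p : Partition n) → Balanced p → k + nonEdgeCut G p ≤ bound n
  rna+nonEdgeCut≤bound p bal = begin
    k + nonEdgeCut G p      ≤⟨ +-monoˡ-≤ _ (proj₂ rna p bal) ⟩
    cut G p + nonEdgeCut G p ≡⟨ cut+nonEdgeCut≡∣V₁∣*∣V₂∣ G p ⟩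
    ∣V₁∣ p * ∣V₂∣ p         ≡⟨ balanced⇒∣V₁∣*∣V₂∣≡bound p bal ⟩
    bound n                 ∎
    where open ≤-Reasoning

  rna≤bound : k ≤ bound n
  rna≤bound = let p , bal , _ = proj₁ rna in ≤-trans (m≤m+n k _) (rna+nonEdgeCut≤bound p bal)

  bound≤rna+ : ∀ c → (∀ p → Balanced p → nonEdgeCut G p ≤ c) → bound n ≤ k + c
  bound≤rna+ c nonEdgeCut≤c = begin
    bound n                   ≡⟨ balanced⇒∣V₁∣*∣V₂∣≡bound p bal ⟨
    ∣V₁∣ p * ∣V₂∣ p           ≡⟨ cut+nonEdgeCut≡∣V₁∣*∣V₂∣ G p ⟨
    cut G p + nonEdgeCut G p  ≤⟨ +-mono-≤ (≤-reflexive cut≡k) (nonEdgeCut≤c p bal) ⟩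
    k + c                     ∎
    where
    open ≤-Reasoning
    p = proj₁ (proj₁ rna)
    bal = proj₁ (proj₂ (proj₁ rna))
    cut≡k = proj₂ (proj₂ (proj₁ rna))

  -- The vertex list T ++ F of each configuration below is ordered so that length T ≡ ⌈ m /2⌉ holds by refl.
  crossable⇒gap : (T F : List (Fin n)) → Unique (T ++ F) → length T ≡ ⌈ length (T ++ F) /2⌉ →
    (es : List (Fin n × Fin n)) → Unique es → All (λ (a , b) → a ∈ T × b ∈ F × a ≁[ G ] b) es →
    k + length es ≤ bound n
  crossable⇒gap T F !T++F ∣T∣≡⌈m/2⌉ es !es es-across with separate T F !T++F ∣T∣≡⌈m/2⌉
  ... | p , bal , T⊆p , F∩p=∅ =
    ≤-trans (+-monoʳ-≤ k (length≤nonEdgeCut G p es !es (All.map across es-across)))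
            (rna+nonEdgeCut≤bound p bal)
    where
    across : ∀ {e} → proj₁ e ∈ T × proj₂ e ∈ F × proj₁ e ≁[ G ] proj₂ e → NonEdgeAcross G p e
    across (a∈T , b∈F , a≁b) = All.lookup T⊆p a∈T , All.lookup F∩p=∅ b∈F , a≁b

  nonEdge⇒gap₁ : ∀ {a b} → a ≢ b → a ≁[ G ] b → k + 1 ≤ bound n
  nonEdge⇒gap₁ a≢b a≁b =
    crossable⇒gap (_ ∷ []) (_ ∷ []) ((a≢b ∷ []) ∷ [] ∷ []) refl (_ ∷ []) ([] ∷ [])
      ((here refl , here refl , a≁b) ∷ [])

  cherry⇒gap₂ : ∀ {x y c} → Unique (x ∷ y ∷ c ∷ []) → x ≁[ G ] c → y ≁[ G ] c → k + 2 ≤ bound n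
  cherry⇒gap₂ !xyc@((x≢y ∷ _) ∷ _) x≁c y≁c =
    crossable⇒gap (_ ∷ _ ∷ []) (_ ∷ []) !xyc refl (_ ∷ _ ∷ []) (((x≢y ∘ ,-injectiveˡ) ∷ []) ∷ [] ∷ [])
      ((here refl , here refl , x≁c) ∷ (there (here refl) , here refl , y≁c) ∷ [])

  matching⇒gap₂ : ∀ {a₁ a₂ b₁ b₂} → Unique (a₁ ∷ a₂ ∷ b₁ ∷ b₂ ∷ []) →
    a₁ ≁[ G ] b₁ → a₂ ≁[ G ] b₂ → k + 2 ≤ bound n
  matching⇒gap₂ !as++bs@((a₁≢a₂ ∷ _) ∷ _) a₁≁b₁ a₂≁b₂ =
    crossable⇒gap (_ ∷ _ ∷ []) (_ ∷ _ ∷ []) !as++bs refl (_ ∷ _ ∷ []) (((a₁≢a₂ ∘ ,-injectiveˡ) ∷ []) ∷ [] ∷ [])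
      ((here refl , here refl , a₁≁b₁) ∷ (there (here refl) , there (here refl) , a₂≁b₂) ∷ [])

  path⇒gap₃ : ∀ {a b c d} → Unique (a ∷ c ∷ b ∷ d ∷ []) →
    a ≁[ G ] b → c ≁[ G ] b → c ≁[ G ] d → k + 3 ≤ bound n
  path⇒gap₃ !acbd@((a≢c ∷ _) ∷ (_ ∷ c≢d ∷ []) ∷ (b≢d ∷ []) ∷ _) a≁b c≁b c≁d =
    crossable⇒gap (_ ∷ _ ∷ []) (_ ∷ _ ∷ []) !acbd refl (_ ∷ _ ∷ _ ∷ [])
      (((a≢c ∘ ,-injectiveˡ) ∷ (a≢c ∘ ,-injectiveˡ) ∷ []) ∷ ((b≢d ∘ ,-injectiveʳ) ∷ []) ∷ [] ∷ [])
      ((here refl , here refl , a≁b) ∷ (there (here refl) , here refl , c≁b) ∷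
       (there (here refl) , there (here refl) , c≁d) ∷ [])

  cherry+edge⇒gap₃ : ∀ {x y a c b} → Unique (x ∷ y ∷ a ∷ c ∷ b ∷ []) →
    x ≁[ G ] c → y ≁[ G ] c → a ≁[ G ] b → k + 3 ≤ bound n
  cherry+edge⇒gap₃ !xyacb@((x≢y ∷ x≢a ∷ _) ∷ (y≢a ∷ _) ∷ _) x≁c y≁c a≁b =
    crossable⇒gap (_ ∷ _ ∷ _ ∷ []) (_ ∷ _ ∷ []) !xyacb refl (_ ∷ _ ∷ _ ∷ [])
      (((x≢y ∘ ,-injectiveˡ) ∷ (x≢a ∘ ,-injectiveˡ) ∷ []) ∷ ((y≢a ∘ ,-injectiveˡ) ∷ []) ∷ [] ∷ [])
      ((here refl , here refl , x≁c) ∷ (there (here refl) , here refl , y≁c) ∷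
       (there (there (here refl)) , there (here refl) , a≁b) ∷ [])

  matching₃⇒gap₃ : ∀ {a₁ a₂ a₃ b₁ b₂ b₃} → Unique (a₁ ∷ a₂ ∷ a₃ ∷ b₁ ∷ b₂ ∷ b₃ ∷ []) →
    a₁ ≁[ G ] b₁ → a₂ ≁[ G ] b₂ → a₃ ≁[ G ] b₃ → k + 3 ≤ bound n
  matching₃⇒gap₃ !as++bs@((a₁≢a₂ ∷ a₁≢a₃ ∷ _) ∷ (a₂≢a₃ ∷ _) ∷ _) a₁≁b₁ a₂≁b₂ a₃≁b₃ =
    crossable⇒gap (_ ∷ _ ∷ _ ∷ []) (_ ∷ _ ∷ _ ∷ []) !as++bs refl (_ ∷ _ ∷ _ ∷ [])
      (((a₁≢a₂ ∘ ,-injectiveˡ) ∷ (a₁≢a₃ ∘ ,-injectiveˡ) ∷ []) ∷ ((a₂≢a₃ ∘ ,-injectiveˡ) ∷ []) ∷ [] ∷ [])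
      ((here refl , here refl , a₁≁b₁) ∷ (there (here refl) , there (here refl) , a₂≁b₂) ∷
       (there (there (here refl)) , there (there (here refl)) , a₃≁b₃) ∷ [])

  -- Without a fifth vertex w the star cannot be cut completely, but then c is isolated.
  star⇒gap₃ : Connected G → ∀ {x y z c} → Unique (x ∷ y ∷ z ∷ c ∷ []) →
    x ≁[ G ] c → y ≁[ G ] c → z ≁[ G ] c → k + 3 ≤ bound n
  star⇒gap₃ conn {x} {y} {z} {c} !xyzc@((x≢y ∷ x≢z ∷ x≢c ∷ []) ∷ (y≢z ∷ _) ∷ _) x≁c y≁c z≁c
    with any? (λ w → ¬? (w ∈? (x ∷ y ∷ z ∷ c ∷ [])))
  ... | yes (w , w∉vs) =
    crossable⇒gap (_ ∷ _ ∷ _ ∷ []) (_ ∷ _ ∷ []) (Unique.++⁺ !xyzc ([] ∷ []) λ { (v∈vs , here refl) → w∉vs v∈vs })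
      refl (_ ∷ _ ∷ _ ∷ [])
      (((x≢y ∘ ,-injectiveˡ) ∷ (x≢z ∘ ,-injectiveˡ) ∷ []) ∷ ((y≢z ∘ ,-injectiveˡ) ∷ []) ∷ [] ∷ [])
      ((here refl , here refl , x≁c) ∷ (there (here refl) , here refl , y≁c) ∷
       (there (there (here refl)) , here refl , z≁c) ∷ [])
  ... | no ∄w = ⊥-elim (connected⇒¬isolated {G = G} conn (x≢c ∘ sym) c≁_)
    where
    c≁_ : ∀ v → c ≁[ G ] v
    c≁ v with v ∈? (x ∷ y ∷ z ∷ c ∷ [])
    ... | no v∉vs = ⊥-elim (∄w (v , v∉vs))
    ... | yes (here refl)                         = trans (Graph.sym G c x) x≁c
    ... | yes (there (here refl))                 = trans (Graph.sym G c y) y≁c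
    ... | yes (there (there (here refl)))         = trans (Graph.sym G c z) z≁c
    ... | yes (there (there (there (here refl)))) = irref G c

  gap-contradiction : ∀ {i j} → k + i ≡ bound n → k + j ≤ bound n → i < j → ⊥
  gap-contradiction {i} {j} k+i≡bound k+j≤bound i<j =
    <⇒≱ i<j (+-cancelˡ-≤ k j i (subst (k + j ≤_) (sym k+i≡bound) k+j≤bound))

  rna+c≡bound : ∀ c → k + c ≤ bound n → (∀ p → Balanced p → nonEdgeCut G p ≤ c) → k + c ≡ bound n
  rna+c≡bound c k+c≤bound nonEdgeCut≤c = ≤-antisym k+c≤bound (bound≤rna+ c nonEdgeCut≤c)

  cherry+outsideEdge⇒gap₃ : Connected G → ∀ {x y c u v} → Unique (x ∷ y ∷ c ∷ []) →
    x ≁[ G ] c → y ≁[ G ] c → u ∉ x ∷ y ∷ c ∷ [] → u ≢ v → u ≁[ G ] v → k + 3 ≤ bound n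
  cherry+outsideEdge⇒gap₃ conn {x} {y} {c} {u} {v} !xyc@((x≢y ∷ x≢c ∷ []) ∷ (y≢c ∷ []) ∷ [] ∷ [])
    x≁c y≁c u∉xyc u≢v u≁v with v ∈? (x ∷ y ∷ c ∷ [])
  ... | yes (here refl) =
    path⇒gap₃ ((u≢c ∷ u≢x ∷ u≢y ∷ []) ∷ (≢-sym x≢c ∷ ≢-sym y≢c ∷ []) ∷ (x≢y ∷ []) ∷ [] ∷ [])
      u≁v (≁-sym G x≁c) (≁-sym G y≁c)
    where u≢x = u∉xyc ∘ here ; u≢y = u∉xyc ∘ there ∘ here ; u≢c = u∉xyc ∘ there ∘ there ∘ here
  ... | yes (there (here refl)) =
    path⇒gap₃ ((u≢c ∷ u≢y ∷ u≢x ∷ []) ∷ (≢-sym y≢c ∷ ≢-sym x≢c ∷ []) ∷ (≢-sym x≢y ∷ []) ∷ [] ∷ [])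
      u≁v (≁-sym G y≁c) (≁-sym G x≁c)
    where u≢x = u∉xyc ∘ here ; u≢y = u∉xyc ∘ there ∘ here ; u≢c = u∉xyc ∘ there ∘ there ∘ here
  ... | yes (there (there (here refl))) = star⇒gap₃ conn (¬Any⇒All¬ _ u∉xyc ∷ !xyc) u≁v x≁c y≁c
  ... | no v∉xyc =
    cherry+edge⇒gap₃ ((x≢y ∷ ≢-sym u≢x ∷ x≢c ∷ ≢-sym v≢x ∷ []) ∷ (≢-sym u≢y ∷ y≢c ∷ ≢-sym v≢y ∷ []) ∷
                      (u≢c ∷ u≢v ∷ []) ∷ (≢-sym v≢c ∷ []) ∷ [] ∷ [])
      x≁c y≁c u≁v
    where
    u≢x = u∉xyc ∘ here ; u≢y = u∉xyc ∘ there ∘ here ; u≢c = u∉xyc ∘ there ∘ there ∘ here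
    v≢x = v∉xyc ∘ here ; v≢y = v∉xyc ∘ there ∘ here ; v≢c = v∉xyc ∘ there ∘ there ∘ here

  cherry-closed : Connected G → k + 2 ≡ bound n → ∀ {x y c} → Unique (x ∷ y ∷ c ∷ []) →
    x ≁[ G ] c → y ≁[ G ] c → ∀ {u v} → u ≢ v → u ≁[ G ] v →
    SameEdge u v x c ⊎ (SameEdge u v c y ⊎ SameEdge u v y x)
  cherry-closed conn k+2≡bound {x} {y} {c} !xyc x≁c y≁c {u} {v} u≢v u≁v
    with u ∈? (x ∷ y ∷ c ∷ []) | v ∈? (x ∷ y ∷ c ∷ [])
  ... | yes u∈xyc | yes v∈xyc = pair-in-triangle u∈xyc v∈xyc u≢v
  ... | no u∉xyc  | _         =
    ⊥-elim (gap-contradiction k+2≡bound (cherry+outsideEdge⇒gap₃ conn !xyc x≁c y≁c u∉xyc u≢v u≁v) ≤-refl)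
  ... | yes _     | no v∉xyc  =
    ⊥-elim (gap-contradiction k+2≡bound
      (cherry+outsideEdge⇒gap₃ conn !xyc x≁c y≁c v∉xyc (≢-sym u≢v) (≁-sym G u≁v)) ≤-refl)

  matching+outsideEdge⇒gap₃ : ∀ {a₁ a₂ b₁ b₂ u v} → Unique (a₁ ∷ a₂ ∷ b₁ ∷ b₂ ∷ []) →
    a₁ ≁[ G ] b₁ → a₂ ≁[ G ] b₂ → u ∉ a₁ ∷ b₁ ∷ [] → u ∉ a₂ ∷ b₂ ∷ [] → v ∉ a₁ ∷ b₁ ∷ [] →
    u ≢ v → u ≁[ G ] v → k + 3 ≤ bound n
  matching+outsideEdge⇒gap₃ {a₁} {a₂} {b₁} {b₂} {u} {v}
    ((a₁≢a₂ ∷ a₁≢b₁ ∷ a₁≢b₂ ∷ []) ∷ (a₂≢b₁ ∷ a₂≢b₂ ∷ []) ∷ (b₁≢b₂ ∷ []) ∷ [] ∷ [])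
    a₁≁b₁ a₂≁b₂ u∉a₁b₁ u∉a₂b₂ v∉a₁b₁ u≢v u≁v with v ∈? (a₂ ∷ b₂ ∷ [])
  ... | yes (here refl) =
    cherry+edge⇒gap₃ ((u≢b₂ ∷ u≢a₁ ∷ u≢v ∷ u≢b₁ ∷ []) ∷ (≢-sym a₁≢b₂ ∷ ≢-sym a₂≢b₂ ∷ ≢-sym b₁≢b₂ ∷ []) ∷
                      (a₁≢a₂ ∷ a₁≢b₁ ∷ []) ∷ (a₂≢b₁ ∷ []) ∷ [] ∷ [])
      u≁v (≁-sym G a₂≁b₂) a₁≁b₁
    where u≢a₁ = u∉a₁b₁ ∘ here ; u≢b₁ = u∉a₁b₁ ∘ there ∘ here ; u≢b₂ = u∉a₂b₂ ∘ there ∘ here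
  ... | yes (there (here refl)) =
    cherry+edge⇒gap₃ ((u≢a₂ ∷ u≢a₁ ∷ u≢v ∷ u≢b₁ ∷ []) ∷ (≢-sym a₁≢a₂ ∷ a₂≢b₂ ∷ a₂≢b₁ ∷ []) ∷
                      (a₁≢b₂ ∷ a₁≢b₁ ∷ []) ∷ (≢-sym b₁≢b₂ ∷ []) ∷ [] ∷ [])
      u≁v a₂≁b₂ a₁≁b₁
    where u≢a₁ = u∉a₁b₁ ∘ here ; u≢b₁ = u∉a₁b₁ ∘ there ∘ here ; u≢a₂ = u∉a₂b₂ ∘ here
  ... | no v∉a₂b₂ =
    matching₃⇒gap₃ ((a₁≢a₂ ∷ ≢-sym u≢a₁ ∷ a₁≢b₁ ∷ a₁≢b₂ ∷ ≢-sym v≢a₁ ∷ []) ∷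
                    (≢-sym u≢a₂ ∷ a₂≢b₁ ∷ a₂≢b₂ ∷ ≢-sym v≢a₂ ∷ []) ∷
                    (u≢b₁ ∷ u≢b₂ ∷ u≢v ∷ []) ∷ (b₁≢b₂ ∷ ≢-sym v≢b₁ ∷ []) ∷ (≢-sym v≢b₂ ∷ []) ∷ [] ∷ [])
      a₁≁b₁ a₂≁b₂ u≁v
    where
    u≢a₁ = u∉a₁b₁ ∘ here ; u≢b₁ = u∉a₁b₁ ∘ there ∘ here
    u≢a₂ = u∉a₂b₂ ∘ here ; u≢b₂ = u∉a₂b₂ ∘ there ∘ here
    v≢a₁ = v∉a₁b₁ ∘ here ; v≢b₁ = v∉a₁b₁ ∘ there ∘ here
    v≢a₂ = v∉a₂b₂ ∘ here ; v≢b₂ = v∉a₂b₂ ∘ there ∘ here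

  matching-closed : k + 2 ≡ bound n → ∀ {a₁ a₂ b₁ b₂} → Unique (a₁ ∷ a₂ ∷ b₁ ∷ b₂ ∷ []) →
    a₁ ≁[ G ] b₁ → a₂ ≁[ G ] b₂ →
    (∀ {u v} → u ≢ v → u ≁[ G ] v → ¬ SameEdge u v a₁ b₁ → u ∉ a₁ ∷ b₁ ∷ []) →
    ∀ {u v} → u ≢ v → u ≁[ G ] v → SameEdge u v a₁ b₁ ⊎ SameEdge u v a₂ b₂
  matching-closed k+2≡bound {a₁} {a₂} {b₁} {b₂} !as++bs a₁≁b₁ a₂≁b₂ avoids {u} {v} u≢v u≁v
    with sameEdge? u v a₁ b₁ | u ∈? (a₂ ∷ b₂ ∷ []) | v ∈? (a₂ ∷ b₂ ∷ [])
  ... | yes uv≡a₁b₁ | _          | _          = inj₁ uv≡a₁b₁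
  ... | no _        | yes u∈a₂b₂ | yes v∈a₂b₂ = inj₂ (pair-in-edge u∈a₂b₂ v∈a₂b₂ u≢v)
  ... | no uv≢a₁b₁  | no u∉a₂b₂  | _          =
    ⊥-elim (gap-contradiction k+2≡bound
      (matching+outsideEdge⇒gap₃ !as++bs a₁≁b₁ a₂≁b₂ (avoids u≢v u≁v uv≢a₁b₁) u∉a₂b₂
        (avoids (≢-sym u≢v) (≁-sym G u≁v) (uv≢a₁b₁ ∘ sameEdge-sym)) u≢v u≁v) ≤-refl)
  ... | no uv≢a₁b₁  | yes _      | no v∉a₂b₂  =
    ⊥-elim (gap-contradiction k+2≡bound
      (matching+outsideEdge⇒gap₃ !as++bs a₁≁b₁ a₂≁b₂ (avoids (≢-sym u≢v) (≁-sym G u≁v) (uv≢a₁b₁ ∘ sameEdge-sym))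
        v∉a₂b₂ (avoids u≢v u≁v uv≢a₁b₁) (≢-sym u≢v) (≁-sym G u≁v)) ≤-refl)

  rna≡bound⇔complete : (k ≡ bound n) ⇔ IsComplete G
  rna≡bound⇔complete = mk⇔ to from
    where
    to : k ≡ bound n → IsComplete G
    to k≡bound u v u≢v =
      ¬-not λ u≁v → gap-contradiction (trans (+-identityʳ k) k≡bound) (nonEdge⇒gap₁ u≢v u≁v) ≤-refl
    from : IsComplete G → k ≡ bound n
    from G-complete = trans (sym (+-identityʳ k)) (rna+c≡bound 0 (≤-trans (≤-reflexive (+-identityʳ k)) rna≤bound)
      λ p _ → nonEdgeCut≤crossings G p [] λ u≢v u≁v → case trans (sym u≁v) (G-complete _ _ u≢v) of λ ())

  rna+1≡bound⇔Kₙ-e : (k + 1 ≡ bound n) ⇔ IsKn-e G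
  rna+1≡bound⇔Kₙ-e = mk⇔ to from
    where
    from : IsKn-e G → k + 1 ≡ bound n
    from (a , b , a≢b , G≡Kₙ-ab) = rna+c≡bound 1 (nonEdge⇒gap₁ a≢b a≁b)
      λ p _ → ≤-trans (KnMinus⇒nonEdgeCut≤crossings G p ((a , b) ∷ []) G≡Kₙ-ab here) (crossings≤length G p ((a , b) ∷ []))
      where a≁b = Equivalence.from (G≡Kₙ-ab a b a≢b) (inj₁ (refl , refl))
    to : k + 1 ≡ bound n → IsKn-e G
    to k+1≡bound with complementShape G
    ... | complete G-complete =
      ⊥-elim (gap-contradiction (trans (+-identityʳ k) (Equivalence.from rna≡bound⇔complete G-complete))
                                (≤-reflexive k+1≡bound) ≤-refl)
    ... | single G≡Kₙ-e = G≡Kₙ-e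
    ... | cherry !xyc x≁c y≁c = ⊥-elim (gap-contradiction k+1≡bound (cherry⇒gap₂ !xyc x≁c y≁c) ≤-refl)
    ... | matching !as++bs a₁≁b₁ a₂≁b₂ _ =
      ⊥-elim (gap-contradiction k+1≡bound (matching⇒gap₂ !as++bs a₁≁b₁ a₂≁b₂) ≤-refl)

  cherry⇒Kₙ-△⊎Kₙ-P₂ : Connected G → k + 2 ≡ bound n → ∀ {x y c} → Unique (x ∷ y ∷ c ∷ []) →
    x ≁[ G ] c → y ≁[ G ] c → IsKn-tri G ⊎ IsKn-P2 G
  cherry⇒Kₙ-△⊎Kₙ-P₂ conn k+2≡bound {x} {y} {c} !xyc@((x≢y ∷ x≢c ∷ []) ∷ (y≢c ∷ []) ∷ [] ∷ []) x≁c y≁c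
    with Adj G y x ≟ᵇ false
  ... | yes y≁x = inj₁ (x , c , y , x≢c , x≢y , ≢-sym y≢c , λ u v u≢v → mk⇔ (closed u≢v)
        [ sameEdge-≁ G x≁c , [ sameEdge-≁ G (≁-sym G y≁c) , sameEdge-≁ G y≁x ] ])
    where closed = cherry-closed conn k+2≡bound !xyc x≁c y≁c
  ... | no ¬y≁x = inj₂ (x , c , y , x≢c , x≢y , ≢-sym y≢c , λ u v u≢v → mk⇔ (λ u≁v → drop-yx u≁v (closed u≢v u≁v))
        [ sameEdge-≁ G x≁c , sameEdge-≁ G (≁-sym G y≁c) ])
    where
    closed = cherry-closed conn k+2≡bound !xyc x≁c y≁c
    drop-yx : ∀ {u v} → u ≁[ G ] v → SameEdge u v x c ⊎ (SameEdge u v c y ⊎ SameEdge u v y x) →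
      SameEdge u v x c ⊎ SameEdge u v c y
    drop-yx _   (inj₁ uv≡xc)         = inj₁ uv≡xc
    drop-yx _   (inj₂ (inj₁ uv≡cy))  = inj₂ uv≡cy
    drop-yx u≁v (inj₂ (inj₂ uv≡yx))  = ⊥-elim (¬y≁x (sameEdge-≁ G u≁v (sameEdge-flip uv≡yx)))

  matching⇒Kₙ-2e : k + 2 ≡ bound n → ∀ {a₁ a₂ b₁ b₂} → Unique (a₁ ∷ a₂ ∷ b₁ ∷ b₂ ∷ []) →
    a₁ ≁[ G ] b₁ → a₂ ≁[ G ] b₂ →
    (∀ {u v} → u ≢ v → u ≁[ G ] v → ¬ SameEdge u v a₁ b₁ → u ∉ a₁ ∷ b₁ ∷ []) → IsKn-2e G
  matching⇒Kₙ-2e k+2≡bound {a₁} {a₂} {b₁} {b₂}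
    !as++bs@((a₁≢a₂ ∷ a₁≢b₁ ∷ a₁≢b₂ ∷ []) ∷ (a₂≢b₁ ∷ a₂≢b₂ ∷ []) ∷ (b₁≢b₂ ∷ []) ∷ [] ∷ []) a₁≁b₁ a₂≁b₂ avoids =
    a₁ , b₁ , a₂ , b₂ , a₁≢b₁ , a₁≢a₂ , a₁≢b₂ , ≢-sym a₂≢b₁ , b₁≢b₂ , a₂≢b₂ ,
    λ u v u≢v → mk⇔ (matching-closed k+2≡bound !as++bs a₁≁b₁ a₂≁b₂ avoids u≢v)
                    [ sameEdge-≁ G a₁≁b₁ , sameEdge-≁ G a₂≁b₂ ]

  rna+2≡bound⇔Kₙ-△⊎Kₙ-2e⊎Kₙ-P₂ : Connected G → (k + 2 ≡ bound n) ⇔ (IsKn-tri G ⊎ (IsKn-2e G ⊎ IsKn-P2 G))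
  rna+2≡bound⇔Kₙ-△⊎Kₙ-2e⊎Kₙ-P₂ conn = mk⇔ to from
    where
    to : k + 2 ≡ bound n → IsKn-tri G ⊎ (IsKn-2e G ⊎ IsKn-P2 G)
    to k+2≡bound with complementShape G
    ... | complete G-complete =
      ⊥-elim (gap-contradiction (trans (+-identityʳ k) (Equivalence.from rna≡bound⇔complete G-complete))
                                (≤-reflexive k+2≡bound) z<s)
    ... | single G≡Kₙ-e =
      ⊥-elim (gap-contradiction (Equivalence.from rna+1≡bound⇔Kₙ-e G≡Kₙ-e) (≤-reflexive k+2≡bound) ≤-refl)
    ... | cherry !xyc x≁c y≁c = map₂ inj₂ (cherry⇒Kₙ-△⊎Kₙ-P₂ conn k+2≡bound !xyc x≁c y≁c)
    ... | matching !as++bs a₁≁b₁ a₂≁b₂ avoids = inj₂ (inj₁ (matching⇒Kₙ-2e k+2≡bound !as++bs a₁≁b₁ a₂≁b₂ avoids))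

    from : IsKn-tri G ⊎ (IsKn-2e G ⊎ IsKn-P2 G) → k + 2 ≡ bound n
    from (inj₁ (a , b , c , a≢b , a≢c , b≢c , G≡Kₙ-abc)) =
      rna+c≡bound 2 (cherry⇒gap₂ ((a≢c ∷ a≢b ∷ []) ∷ (≢-sym b≢c ∷ []) ∷ [] ∷ []) a≁b (≁-sym G b≁c))
        λ p _ → ≤-trans (KnMinus⇒nonEdgeCut≤crossings G p ((a , b) ∷ (b , c) ∷ (c , a) ∷ []) G≡Kₙ-abc
                           [ here , [ there ∘ here , there ∘ there ∘ here ] ])
                        (crossings-triangle G p a b c)
      where
      a≁b = Equivalence.from (G≡Kₙ-abc a b a≢b) (inj₁ (inj₁ (refl , refl)))
      b≁c = Equivalence.from (G≡Kₙ-abc b c b≢c) (inj₂ (inj₁ (inj₁ (refl , refl))))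
    from (inj₂ (inj₁ (a , b , c , d , a≢b , a≢c , a≢d , b≢c , b≢d , c≢d , G≡Kₙ-ab-cd))) =
      rna+c≡bound 2 (matching⇒gap₂ ((a≢c ∷ a≢b ∷ a≢d ∷ []) ∷ (≢-sym b≢c ∷ c≢d ∷ []) ∷ (b≢d ∷ []) ∷ [] ∷ []) a≁b c≁d)
        λ p _ → ≤-trans (KnMinus⇒nonEdgeCut≤crossings G p ((a , b) ∷ (c , d) ∷ []) G≡Kₙ-ab-cd [ here , there ∘ here ])
                        (crossings≤length G p ((a , b) ∷ (c , d) ∷ []))
      where
      a≁b = Equivalence.from (G≡Kₙ-ab-cd a b a≢b) (inj₁ (inj₁ (refl , refl)))
      c≁d = Equivalence.from (G≡Kₙ-ab-cd c d c≢d) (inj₂ (inj₁ (refl , refl)))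
    from (inj₂ (inj₂ (a , b , c , a≢b , a≢c , b≢c , G≡Kₙ-ab-bc))) =
      rna+c≡bound 2 (cherry⇒gap₂ ((a≢c ∷ a≢b ∷ []) ∷ (≢-sym b≢c ∷ []) ∷ [] ∷ []) a≁b (≁-sym G b≁c))
        λ p _ → ≤-trans (KnMinus⇒nonEdgeCut≤crossings G p ((a , b) ∷ (b , c) ∷ []) G≡Kₙ-ab-bc [ here , there ∘ here ])
                        (crossings≤length G p ((a , b) ∷ (b , c) ∷ []))
      where
      a≁b = Equivalence.from (G≡Kₙ-ab-bc a b a≢b) (inj₁ (inj₁ (refl , refl)))
      b≁c = Equivalence.from (G≡Kₙ-ab-bc b c b≢c) (inj₂ (inj₁ (refl , refl)))

theorem1 : ∀ (n : ℕ) (G : Graph n) → Connected G → ∀ (k : ℕ) → IsRna G k →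
    (k ≤ bound n)
    × ((k ≡ bound n) ⇔ IsComplete G)
    × ((k + 1 ≡ bound n) ⇔ IsKn-e G)
    × ((k + 2 ≡ bound n) ⇔ (IsKn-tri G ⊎ (IsKn-2e G ⊎ IsKn-P2 G)))
theorem1 n G conn k rna =
  rna≤bound , rna≡bound⇔complete , rna+1≡bound⇔Kₙ-e , rna+2≡bound⇔Kₙ-△⊎Kₙ-2e⊎Kₙ-P₂ conn
  where open RnaFacts {G = G} rna
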